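{- Let $A$ be a finite alphabet and let $F$ be a dill map on $A^{\mathbb N}$ with diameter $\theta\in\mathbb N\setminus\{0\}$ and local rule $f$. If $F$ induces a well-defined map on the Weyl space (i.e. $W_H(x,y)=0$ implies $W_H(F(x),F(y))=0$ for all $x,y\in A^{\mathbb N}$), then $F$ is either constant or uniform.
   Context: Write $u_{[a,b)}=u_a\cdots u_{b-1}$. $d_H(u,v)=|\{i:u_i\ne v_i\}|$ for words of equal length. $W_H(x,y)=\limsup_{\ell\to\infty}\max_{k\in\mathbb N}\frac{d_H(x_{[k,k+\ell)},y_{[k,k+\ell)})}{\ell}$. A dill map with diameter $\theta$ and local rule $f:A^\theta\to A^+$ (nonempty words) is $F(x)=f(x_{[0,\theta)})f(x_{[1,\theta+1)})\cdots$. $F$ is uniform if $|f(u)|=|f(v)|$ for all $u,v\in A^\theta$; $F$ is constant if $F(x)=F(y)$ for all $x,y$. -}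

module Defs where

open import Data.Nat using (ℕ; zero; suc; _+_; _*_; _≤_; _<?_)
open import Data.Fin using (Fin; toℕ; _≟_)
open import Data.Vec using (Vec; tabulate)
open import Data.List using ([]; _∷_)
open import Data.List.NonEmpty using (List⁺; _∷_; length)
open import Data.Product using (_×_; _,_; proj₁; proj₂; ∃-syntax)
open import Relation.Nullary using (yes; no)
open import Relation.Binary.PropositionalEquality using (_≡_)

Seq : ℕ → Set
Seq n = ℕ → Fin n

window : ∀ {n} (θ : ℕ) → Seq n → ℕ → Vec (Fin n) θ
window θ x k = tabulate (λ i → x (k + toℕ i))

dH : ∀ {n} → Seq n → Seq n → (k ℓ : ℕ) → ℕ
dH x y k zero = 0
dH x y k (suc ℓ) with x (k + ℓ) ≟ y (k + ℓ)
... | yes _ = dH x y k ℓ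
... | no  _ = suc (dH x y k ℓ)

-- W_H(x,y) = 0, unfolded: for every ε = 1/(m+1) there is L such that for all
-- ℓ ≥ L and all k, d_H(x_{[k,k+ℓ)}, y_{[k,k+ℓ)}) / ℓ ≤ ε.
WeylZero : ∀ {n} → Seq n → Seq n → Set
WeylZero x y = ∀ (m : ℕ) → ∃[ L ] (∀ (ℓ : ℕ) → L ≤ ℓ → ∀ (k : ℕ) → suc m * dH x y k ℓ ≤ ℓ)

index⁺ : ∀ {a} {A : Set a} → List⁺ A → ℕ → A
index⁺ (a ∷ []) r = a
index⁺ (a ∷ b ∷ bs) zero = a
index⁺ (a ∷ b ∷ bs) (suc r) = index⁺ (b ∷ bs) r

-- Position in the concatenation w₀ w₁ w₂ ⋯ of nonempty words:
-- (j , r) means letter r of word w_j.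
pos : ∀ {a} {A : Set a} → (ℕ → List⁺ A) → ℕ → ℕ × ℕ
pos w zero = 0 , 0
pos w (suc i) with pos w i
... | j , r with suc r <? length (w j)
...   | yes _ = j , suc r
...   | no  _ = suc j , 0

concatω : ∀ {a} {A : Set a} → (ℕ → List⁺ A) → ℕ → A
concatω w i = index⁺ (w (proj₁ (pos w i))) (proj₂ (pos w i))

dill : ∀ {n} (θ : ℕ) → (Vec (Fin n) θ → List⁺ (Fin n)) → Seq n → Seq n
dill θ f x = concatω (λ k → f (window θ x k))

IsConstant : ∀ {n} → (Seq n → Seq n) → Set
IsConstant F = ∀ x y → ∀ i → F x i ≡ F y i

IsUniform : ∀ {n} (θ : ℕ) → (Vec (Fin n) θ → List⁺ (Fin n)) → Set
IsUniform θ f = ∀ u v → length (f u) ≡ length (f v)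

-- Fix a periodic point Z of the shift σ. Its image z = F Z is periodic, so
-- a ∼ b :⇔ σᵃ z = σᵇ z is a congruence on ℕ admitting cancellation. Changing finitely
-- many letters preserves the Weyl class, so the images of Z and of Z with its first θ
-- letters replaced are Weyl-equivalent; both are periodic from some point on, hence
-- they agree there. Thus the total length of the first θ image words is the same
-- modulo ∼ whatever those letters are, and peeling off one word at a time gives
-- |f u| ∼ |f v| for all u, v. If |f u| ≠ |f v|, their difference is therefore a
-- period of z. Choosing Z to read x on [0, N) and y on [N, 2N), with N a multiple of
-- that period, the shift of z to the start of the image of y is z itself; hence
-- F x = F y.
module Submission where

open import Defs
open import Data.Fin using (Fin; toℕ; fromℕ<) renaming (_≟_ to _≟ᶠ_)
open import Data.Fin.Properties using (toℕ<n; toℕ-fromℕ<; fromℕ<-toℕ; all?)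
open import Data.List.NonEmpty using (List⁺; _∷_; length)
open import Data.Nat
  using (ℕ; zero; suc; pred; _+_; _*_; _∸_; _≤_; _<_; _≤?_; _<?_; _≟_; z≤n; s≤s; _%_)
open import Data.Nat.DivMod using ([m+n]%n≡m%n; m<n⇒m%n≡m)
open import Data.Nat.Properties
open import Data.Nat.Tactic.RingSolver using (solve-∀)
open import Data.Product using (_×_; _,_; proj₁; proj₂; ∃-syntax)
open import Data.Sum using (_⊎_; inj₁; inj₂)
open import Data.Vec using (Vec; []; _∷_; tabulate; lookup)
open import Data.Vec.Properties using (tabulate-cong; tabulate∘lookup; lookup∘tabulate)
open import Relation.Binary using (Setoid; IsEquivalence; tri<; tri≈; tri>)
open import Relation.Binary.PropositionalEquality
open import Relation.Nullary using (Dec; yes; no; ¬_; contradiction)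
open import Relation.Nullary.Decidable using (map′; decidable-stable)
import Relation.Binary.Reasoning.Setoid as SetoidReasoning

Periodic : {A : Set} → ℕ → (ℕ → A) → Set
Periodic P g = ∀ t → g (t + P) ≡ g t

AgreeFrom : {A : Set} → ℕ → (ℕ → A) → (ℕ → A) → Set
AgreeFrom m x y = ∀ t → m ≤ t → x t ≡ y t

AgreeBelow : {A : Set} → ℕ → (ℕ → A) → (ℕ → A) → Set
AgreeBelow m x y = ∀ t → t < m → x t ≡ y t

splice : ∀ {A : Set} → ℕ → (ℕ → A) → (ℕ → A) → ℕ → A
splice N x y r with r <? N
... | yes _ = x r
... | no  _ = y (r ∸ N)

splice-< : ∀ {A : Set} {N} (x y : ℕ → A) {r} → r < N → splice N x y r ≡ x r
splice-< {N = N} x y {r} r<N with r <? N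
... | yes _   = refl
... | no  r≮N = contradiction r<N r≮N

splice-+ : ∀ {A : Set} N (x y : ℕ → A) s → splice N x y (N + s) ≡ y s
splice-+ N x y s with N + s <? N
... | yes N+s<N = contradiction (m≤m+n N s) (<⇒≱ N+s<N)
... | no  _     = cong y (m+n∸m≡n N s)

periodic-* : ∀ {A : Set} {P} {g : ℕ → A} → Periodic P g → ∀ c t → g (t + c * P) ≡ g t
periodic-* {g = g} per zero    t = cong g (+-identityʳ t)
periodic-* {P = P} {g} per (suc c) t = begin
  g (t + (P + c * P))  ≡⟨ cong g (+-assoc t P (c * P)) ⟨
  g (t + P + c * P)    ≡⟨ periodic-* per c (t + P) ⟩
  g (t + P)            ≡⟨ per t ⟩
  g t                  ∎
  where open ≡-Reasoning

∀-Vec? : ∀ {m} k {P : Vec (Fin m) k → Set} → (∀ v → Dec (P v)) → Dec (∀ v → P v)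
∀-Vec? zero    P? = map′ (λ { p [] → p }) (λ h → h []) (P? [])
∀-Vec? (suc k) P? = map′ (λ { h (a ∷ v) → h a v }) (λ h a v → h (a ∷ v))
                         (all? λ a → ∀-Vec? k λ v → P? (a ∷ v))

0<length : ∀ {A : Set} (u : List⁺ A) → 0 < length u
0<length (_ ∷ _) = s≤s z≤n

module Concatenation {A : Set} (w : ℕ → List⁺ A) where

  offset : ℕ → ℕ
  offset zero    = 0
  offset (suc j) = offset j + length (w j)

  0<offset-suc : ∀ j → 0 < offset (suc j)
  0<offset-suc j = ≤-trans (0<length (w j)) (m≤n+m _ (offset j))

  ≤-offset : ∀ j → j ≤ offset j
  ≤-offset zero    = z≤n
  ≤-offset (suc j) = ≤-trans (≤-reflexive (+-comm 1 j)) (+-mono-≤ (≤-offset j) (0<length (w j)))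

  pos-step-within : ∀ i {j r} → pos w i ≡ (j , r) → suc r < length (w j) →
                    pos w (suc i) ≡ (j , suc r)
  pos-step-within i {j} {r} eq lt rewrite eq with suc r <? length (w j)
  ... | yes _  = refl
  ... | no  r≮ = contradiction lt r≮

  pos-step-next : ∀ i {j r} → pos w i ≡ (j , r) → ¬ suc r < length (w j) →
                  pos w (suc i) ≡ (suc j , 0)
  pos-step-next i {j} {r} eq r≮ rewrite eq with suc r <? length (w j)
  ... | yes lt = contradiction lt r≮
  ... | no  _  = refl

  pos-offset : ∀ j r → r < length (w j) → pos w (offset j + r) ≡ (j , r)
  pos-offset zero    zero    _  = refl
  pos-offset (suc j) zero    _  with m≤n⇒∃[o]m+o≡n (0<length (w j))
  ... | last , 1+last≡len = begin
    pos w (offset j + length (w j) + 0)  ≡⟨ cong (pos w) arith ⟩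
    pos w (suc (offset j + last))        ≡⟨ pos-step-next (offset j + last) last-letter (<-irrefl 1+last≡len) ⟩
    (suc j , 0)                          ∎
    where
    open ≡-Reasoning
    last<len : last < length (w j)
    last<len = ≤-reflexive 1+last≡len
    last-letter : pos w (offset j + last) ≡ (j , last)
    last-letter = pos-offset j last last<len
    arith : offset j + length (w j) + 0 ≡ suc (offset j + last)
    arith = trans (+-identityʳ _)
      (trans (cong (offset j +_) (sym 1+last≡len)) (+-suc (offset j) last))
  pos-offset j       (suc r) lt = trans (cong (pos w) (+-suc (offset j) r))
    (pos-step-within (offset j + r) (pos-offset j r (<⇒≤ lt)) lt)

  decompose : ∀ i → ∃[ j ] ∃[ r ] r < length (w j) × offset j + r ≡ i
  decompose zero = 0 , 0 , 0<length (w 0) , refl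
  decompose (suc i) with decompose i
  ... | j , r , r<len , eq with suc r <? length (w j)
  ...   | yes r+1<len = j , suc r , r+1<len , trans (+-suc (offset j) r) (cong suc eq)
  ...   | no  r+1≮len = suc j , 0 , 0<length (w (suc j)) , next-word
    where
    open ≡-Reasoning
    next-word : offset j + length (w j) + 0 ≡ suc i
    next-word = begin
      offset j + length (w j) + 0   ≡⟨ +-identityʳ _ ⟩
      offset j + length (w j)       ≡⟨ cong (offset j +_) (≤-antisym r<len (≮⇒≥ r+1≮len)) ⟨
      offset j + suc r              ≡⟨ +-suc (offset j) r ⟩
      suc (offset j + r)            ≡⟨ cong suc eq ⟩
      suc i                         ∎

  concatω-offset : ∀ {j r} → r < length (w j) → concatω w (offset j + r) ≡ index⁺ (w j) r
  concatω-offset {j} {r} lt rewrite pos-offset j r lt = refl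

open Concatenation using (offset; ≤-offset; decompose; concatω-offset)

offset-cong : ∀ {A : Set} {w w' : ℕ → List⁺ A} j → (∀ k → k < j → w k ≡ w' k) →
              offset w j ≡ offset w' j
offset-cong zero    _  = refl
offset-cong (suc j) eq =
  cong₂ _+_ (offset-cong j λ k k<j → eq k (m<n⇒m<1+n k<j)) (cong length (eq j ≤-refl))

concatω-local : ∀ {A : Set} {w w' : ℕ → List⁺ A} i → (∀ j → j ≤ i → w j ≡ w' j) →
                concatω w i ≡ concatω w' i
concatω-local {w = w} {w'} i eq with decompose w i
... | j , r , r<len , offset+r≡i = begin
  concatω w i                   ≡⟨ cong (concatω w) offset+r≡i ⟨
  concatω w (offset w j + r)    ≡⟨ concatω-offset w r<len ⟩
  index⁺ (w j) r                ≡⟨ cong (λ u → index⁺ u r) wj≡w'j ⟩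
  index⁺ (w' j) r               ≡⟨ concatω-offset w' (subst (λ u → r < length u) wj≡w'j r<len) ⟨
  concatω w' (offset w' j + r)  ≡⟨ cong (λ o → concatω w' (o + r)) offsets-equal ⟨
  concatω w' (offset w j + r)   ≡⟨ cong (concatω w') offset+r≡i ⟩
  concatω w' i                  ∎
  where
  open ≡-Reasoning
  j≤i : j ≤ i
  j≤i = ≤-trans (≤-offset w j) (≤-trans (m≤m+n _ r) (≤-reflexive offset+r≡i))
  wj≡w'j : w j ≡ w' j
  wj≡w'j = eq j j≤i
  offsets-equal : offset w j ≡ offset w' j
  offsets-equal = offset-cong j λ k k<j → eq k (≤-trans (<⇒≤ k<j) j≤i)

offset-shift : ∀ {A : Set} (w : ℕ → List⁺ A) k j →
               offset w k + offset (λ t → w (k + t)) j ≡ offset w (k + j)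
offset-shift w k zero    = trans (+-identityʳ _) (cong (offset w) (sym (+-identityʳ k)))
offset-shift w k (suc j) = begin
  offset w k + (offset w' j + length (w (k + j)))  ≡⟨ +-assoc (offset w k) _ _ ⟨
  offset w k + offset w' j + length (w (k + j))    ≡⟨ cong (_+ length (w (k + j))) (offset-shift w k j) ⟩
  offset w (k + j) + length (w (k + j))            ≡⟨ cong (offset w) (+-suc k j) ⟨
  offset w (k + suc j)                             ∎
  where
  open ≡-Reasoning
  w' = λ t → w (k + t)

concatω-shift : ∀ {A : Set} (w : ℕ → List⁺ A) k t →
                concatω w (offset w k + t) ≡ concatω (λ j → w (k + j)) t
concatω-shift w k t with decompose (λ j → w (k + j)) t
... | j , r , r<len , offset+r≡t = begin
  concatω w (offset w k + t)                 ≡⟨ cong (λ s → concatω w (offset w k + s)) offset+r≡t ⟨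
  concatω w (offset w k + (offset w' j + r)) ≡⟨ cong (concatω w) arith ⟩
  concatω w (offset w (k + j) + r)           ≡⟨ concatω-offset w r<len ⟩
  index⁺ (w (k + j)) r                       ≡⟨ concatω-offset w' r<len ⟨
  concatω w' (offset w' j + r)               ≡⟨ cong (concatω w') offset+r≡t ⟩
  concatω w' t                               ∎
  where
  open ≡-Reasoning
  w' = λ j → w (k + j)
  arith : offset w k + (offset w' j + r) ≡ offset w (k + j) + r
  arith = trans (sym (+-assoc (offset w k) _ r)) (cong (_+ r) (offset-shift w k j))

module Hamming {n : ℕ} (x y : Seq n) where

  dH≤length : ∀ k ℓ → dH x y k ℓ ≤ ℓ
  dH≤length k zero = z≤n
  dH≤length k (suc ℓ) with x (k + ℓ) ≟ᶠ y (k + ℓ)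
  ... | yes _ = m≤n⇒m≤1+n (dH≤length k ℓ)
  ... | no  _ = s≤s (dH≤length k ℓ)

  agreeFrom⇒dH≤ : ∀ m → AgreeFrom m x y → ∀ k ℓ → dH x y k ℓ ≤ m
  agreeFrom⇒dH≤ m agree k zero = z≤n
  agreeFrom⇒dH≤ m agree k (suc ℓ) with m ≤? k + ℓ
  ... | no  m≰k+ℓ = ≤-trans (dH≤length k (suc ℓ)) (≤-trans (s≤s (m≤n+m ℓ k)) (≰⇒> m≰k+ℓ))
  ... | yes m≤k+ℓ with x (k + ℓ) ≟ᶠ y (k + ℓ)
  ...   | yes _  = agreeFrom⇒dH≤ m agree k ℓ
  ...   | no  ne = contradiction (agree _ m≤k+ℓ) ne

  agreeFrom⇒WeylZero : ∀ m → AgreeFrom m x y → WeylZero x y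
  agreeFrom⇒WeylZero m agree m' =
    suc m' * m , λ ℓ L≤ℓ k → ≤-trans (*-monoʳ-≤ (suc m') (agreeFrom⇒dH≤ m agree k ℓ)) L≤ℓ

  dH-suc-≢ : ∀ k ℓ → x (k + ℓ) ≢ y (k + ℓ) → dH x y k (suc ℓ) ≡ suc (dH x y k ℓ)
  dH-suc-≢ k ℓ ne with x (k + ℓ) ≟ᶠ y (k + ℓ)
  ... | yes eq = contradiction eq ne
  ... | no  _  = refl

  dH-≤-suc : ∀ k ℓ → dH x y k ℓ ≤ dH x y k (suc ℓ)
  dH-≤-suc k ℓ with x (k + ℓ) ≟ᶠ y (k + ℓ)
  ... | yes _ = ≤-refl
  ... | no  _ = n≤1+n _

  dH-≤-+ : ∀ k ℓ r → dH x y k ℓ ≤ dH x y k (ℓ + r)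
  dH-≤-+ k ℓ zero    = ≤-reflexive (cong (dH x y k) (sym (+-identityʳ ℓ)))
  dH-≤-+ k ℓ (suc r) = ≤-trans (dH-≤-+ k ℓ r)
    (≤-trans (dH-≤-suc k (ℓ + r)) (≤-reflexive (cong (dH x y k) (sym (+-suc ℓ r)))))

open Hamming using (agreeFrom⇒WeylZero)

-- A mismatch at T + t recurs every P steps, so the window of length (L+1)P starting
-- there has at least L+1 mismatches, more than the bound ℓ/(P+1) given by W_H(x, y) = 0.
periodic-WeylZero⇒agree : ∀ {n} (x y : Seq n) T p →
  Periodic (suc p) (λ t → x (T + t)) → Periodic (suc p) (λ t → y (T + t)) →
  WeylZero x y → ∀ t → x (T + t) ≡ y (T + t)
periodic-WeylZero⇒agree x y T p x-periodic y-periodic weyl t with x (T + t) ≟ᶠ y (T + t)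
... | yes eq = eq
... | no  ne = contradiction (proj₂ (weyl P) ℓ L≤ℓ (T + t)) (<⇒≱ too-many)
  where
  open Hamming x y
  P = suc p
  L = proj₁ (weyl P)
  ℓ = suc L * P

  L≤ℓ : L ≤ ℓ
  L≤ℓ = ≤-trans (m≤m*n L P) (m≤n+m (L * P) P)

  mismatch : ∀ c → x (T + t + c * P) ≢ y (T + t + c * P)
  mismatch c eq = ne (begin
    x (T + t)            ≡⟨ periodic-* x-periodic c t ⟨
    x (T + (t + c * P))  ≡⟨ cong x (+-assoc T t _) ⟨
    x (T + t + c * P)    ≡⟨ eq ⟩
    y (T + t + c * P)    ≡⟨ cong y (+-assoc T t _) ⟩
    y (T + (t + c * P))  ≡⟨ periodic-* y-periodic c t ⟩
    y (T + t)            ∎)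
    where open ≡-Reasoning

  count : ∀ c → c ≤ dH x y (T + t) (c * P)
  count zero    = z≤n
  count (suc c) = begin
    suc c                                 ≤⟨ s≤s (count c) ⟩
    suc (dH x y (T + t) (c * P))          ≡⟨ dH-suc-≢ (T + t) (c * P) (mismatch c) ⟨
    dH x y (T + t) (suc (c * P))          ≤⟨ dH-≤-+ (T + t) (suc (c * P)) p ⟩
    dH x y (T + t) (suc (c * P + p))      ≡⟨ cong (λ s → dH x y (T + t) (suc s)) (+-comm (c * P) p) ⟩
    dH x y (T + t) (suc c * P)            ∎
    where open ≤-Reasoning

  too-many : ℓ < suc P * dH x y (T + t) ℓ
  too-many = begin-strict
    suc L * P                      ≡⟨ *-comm (suc L) P ⟩
    P * suc L                      <⟨ m<n+m (P * suc L) (s≤s z≤n) ⟩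
    suc P * suc L                  ≤⟨ *-monoʳ-≤ (suc P) (count (suc L)) ⟩
    suc P * dH x y (T + t) ℓ       ∎
    where open ≤-Reasoning

module ShiftEquivalence {A : Set} (z : ℕ → A) (p : ℕ) (z-periodic : Periodic (suc p) z) where

  infix 4 _∼_
  record _∼_ (a b : ℕ) : Set where
    constructor shiftEq
    field shifts-agree : ∀ t → z (a + t) ≡ z (b + t)
  open _∼_ public

  ∼-isEquivalence : IsEquivalence _∼_
  ∼-isEquivalence = record
    { refl  = shiftEq λ _ → refl
    ; sym   = λ a∼b → shiftEq λ t → sym (shifts-agree a∼b t)
    ; trans = λ a∼b b∼c → shiftEq λ t → trans (shifts-agree a∼b t) (shifts-agree b∼c t)
    }

  ∼-setoid : Setoid _ _
  ∼-setoid = record { isEquivalence = ∼-isEquivalence }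

  open IsEquivalence ∼-isEquivalence public
    using () renaming (refl to ∼-refl; trans to ∼-trans; reflexive to ∼-reflexive)

  module ∼-Reasoning = SetoidReasoning ∼-setoid

  +-congˡ : ∀ {a b} c → a ∼ b → c + a ∼ c + b
  +-congˡ {a} {b} c a∼b = shiftEq λ t → begin
    z (c + a + t)    ≡⟨ cong z (swap a) ⟩
    z (a + (c + t))  ≡⟨ shifts-agree a∼b (c + t) ⟩
    z (b + (c + t))  ≡⟨ cong z (swap b) ⟨
    z (c + b + t)    ∎
    where
    open ≡-Reasoning
    swap : ∀ d {t} → c + d + t ≡ d + (c + t)
    swap d {t} = trans (cong (_+ t) (+-comm c d)) (+-assoc d c t)

  +-cong : ∀ {a b c d} → a ∼ b → c ∼ d → a + c ∼ b + d
  +-cong {a} {b} {c} {d} a∼b c∼d = begin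
    a + c  ≈⟨ +-congˡ a c∼d ⟩
    a + d  ≡⟨ +-comm a d ⟩
    d + a  ≈⟨ +-congˡ d a∼b ⟩
    d + b  ≡⟨ +-comm d b ⟩
    b + d  ∎
    where open ∼-Reasoning

  -- The shift by c is undone by the multiple c * (p + 1) of the period of z.
  +-cancelˡ : ∀ {a b} c → c + a ∼ c + b → a ∼ b
  +-cancelˡ {a} {b} c ca∼cb = shiftEq λ t → begin
    z (a + t)                    ≡⟨ periodic-* z-periodic c (a + t) ⟨
    z (a + t + c * suc p)        ≡⟨ cong z (rearrange a t) ⟩
    z (c + a + (t + c * p))      ≡⟨ shifts-agree ca∼cb (t + c * p) ⟩
    z (c + b + (t + c * p))      ≡⟨ cong z (rearrange b t) ⟨
    z (b + t + c * suc p)        ≡⟨ periodic-* z-periodic c (b + t) ⟩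
    z (b + t)                    ∎
    where
    open ≡-Reasoning
    reassociate : ∀ d t c q → d + t + (c + q) ≡ c + d + (t + q)
    reassociate = solve-∀
    rearrange : ∀ d t → d + t + c * suc p ≡ c + d + (t + c * p)
    rearrange d t = trans (cong (d + t +_) (*-suc c p)) (reassociate d t c (c * p))

  +-cancelʳ : ∀ {a b c d} → a + c ∼ b + d → c ∼ d → a ∼ b
  +-cancelʳ {a} {b} {c} {d} ac∼bd c∼d = +-cancelˡ c (begin
    c + a  ≡⟨ +-comm c a ⟩
    a + c  ≈⟨ ac∼bd ⟩
    b + d  ≈⟨ +-congˡ b c∼d ⟨
    b + c  ≡⟨ +-comm b c ⟩
    c + b  ∎)
    where open ∼-Reasoning

  difference∼0 : ∀ {a b d} → a ∼ b → a + d ≡ b → d ∼ 0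
  difference∼0 {a} {b} {d} a∼b a+d≡b = +-cancelˡ a (begin
    a + d  ≡⟨ a+d≡b ⟩
    b      ≈⟨ a∼b ⟨
    a      ≡⟨ +-identityʳ a ⟨
    a + 0  ∎)
    where open ∼-Reasoning

  *-∼0 : ∀ {d} → d ∼ 0 → ∀ m → d * m ∼ 0
  *-∼0 {d} d∼0 zero    = ∼-reflexive (*-zeroʳ d)
  *-∼0 {d} d∼0 (suc m) = ∼-trans (∼-reflexive (*-suc d m)) (+-cong d∼0 (*-∼0 d∼0 m))

  offset-cong-∼ : ∀ {B : Set} {w w' : ℕ → List⁺ B} →
                  (∀ j → length (w j) ∼ length (w' j)) → ∀ m → offset w m ∼ offset w' m
  offset-cong-∼ lengths∼ zero    = ∼-refl
  offset-cong-∼ lengths∼ (suc m) = +-cong (offset-cong-∼ lengths∼ m) (lengths∼ m)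

  offset-∼-* : ∀ {B : Set} {w : ℕ → List⁺ B} {c} →
               (∀ j → length (w j) ∼ c) → ∀ m → offset w m ∼ m * c
  offset-∼-*         lengths∼ zero    = ∼-refl
  offset-∼-* {c = c} lengths∼ (suc m) =
    ∼-trans (+-cong (offset-∼-* lengths∼ m) (lengths∼ m)) (∼-reflexive (+-comm (m * c) c))

module DillMap {n : ℕ} (θ : ℕ) (f : Vec (Fin n) θ → List⁺ (Fin n)) where

  F : Seq n → Seq n
  F = dill θ f

  words : Seq n → ℕ → List⁺ (Fin n)
  words X k = f (window θ X k)

  offsets : Seq n → ℕ → ℕ
  offsets X = offset (words X)

  |f₀| : Seq n → ℕ
  |f₀| X = length (words X 0)

  shift : ℕ → Seq n → Seq n
  shift j X t = X (j + t)

  σ : Seq n → Seq n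
  σ = shift 1

  window-local : ∀ {X Y : Seq n} k → (∀ r → r < θ → X (k + r) ≡ Y (k + r)) →
                 window θ X k ≡ window θ Y k
  window-local k agree = tabulate-cong λ r → agree (toℕ r) (toℕ<n r)

  dill-local : ∀ {X Y} i → AgreeBelow (i + θ) X Y → F X i ≡ F Y i
  dill-local {X} {Y} i agree = concatω-local i λ j j≤i →
    cong f (window-local {X} {Y} j λ r r<θ → agree (j + r) (+-mono-≤-< j≤i r<θ))

  dill-cong : ∀ {X Y} → (∀ t → X t ≡ Y t) → ∀ i → F X i ≡ F Y i
  dill-cong X≗Y i = dill-local i λ t _ → X≗Y t

  dill-shift : ∀ X k t → F X (offsets X k + t) ≡ F (shift k X) t
  dill-shift X k t = trans (concatω-shift (words X) k t) (concatω-local t λ j _ →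
    cong f (tabulate-cong λ r → cong X (+-assoc k j (toℕ r))))

  dill-tail : ∀ {X Y} k → AgreeFrom k X Y → ∀ t → F X (offsets X k + t) ≡ F Y (offsets Y k + t)
  dill-tail {X} {Y} k agree t = begin
    F X (offsets X k + t)  ≡⟨ dill-shift X k t ⟩
    F (shift k X) t        ≡⟨ dill-cong (λ s → agree (k + s) (m≤m+n k s)) t ⟩
    F (shift k Y) t        ≡⟨ dill-shift Y k t ⟨
    F Y (offsets Y k + t)  ∎
    where open ≡-Reasoning

  offsets-suc : ∀ X m → offsets X (suc m) ≡ |f₀| X + offsets (σ X) m
  offsets-suc X m = sym (offset-shift (words X) 1 m)

  extend : Vec (Fin n) θ → Seq n → Seq n
  extend u X t with t <? θ
  ... | yes t<θ = lookup u (fromℕ< t<θ)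
  ... | no  _   = X t

  extend-< : ∀ u X {t} (t<θ : t < θ) → extend u X t ≡ lookup u (fromℕ< t<θ)
  extend-< u X {t} t<θ with t <? θ
  ... | yes _   = refl
  ... | no  t≮θ = contradiction t<θ t≮θ

  extend-≥ : ∀ u X {t} → θ ≤ t → extend u X t ≡ X t
  extend-≥ u X {t} θ≤t with t <? θ
  ... | yes t<θ = contradiction θ≤t (<⇒≱ t<θ)
  ... | no  _   = refl

  window-extend : ∀ u X → window θ (extend u X) 0 ≡ u
  window-extend u X = trans
    (tabulate-cong λ r → trans (extend-< u X (toℕ<n r)) (cong (lookup u) (fromℕ<-toℕ r (toℕ<n r))))
    (tabulate∘lookup u)

  extend-window : ∀ X Y {t} → t < θ → extend (window θ X 0) Y t ≡ X t
  extend-window X Y {t} t<θ = trans (extend-< _ Y t<θ)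
    (trans (lookup∘tabulate _ (fromℕ< t<θ)) (cong X (toℕ-fromℕ< t<θ)))

uniform? : ∀ {n} θ (f : Vec (Fin n) θ → List⁺ (Fin n)) → Dec (IsUniform θ f)
uniform? θ f = ∀-Vec? θ λ u → ∀-Vec? θ λ v → length (f u) ≟ length (f v)

PreservesWeylZero : ∀ {n} → (Seq n → Seq n) → Set
PreservesWeylZero F = ∀ x y → WeylZero x y → WeylZero (F x) (F y)

module WeylInvariant {n θ' : ℕ} (f : Vec (Fin n) (suc θ') → List⁺ (Fin n))
                     (preserves : PreservesWeylZero (dill (suc θ') f)) where

  open DillMap (suc θ') f

  private
    θ : ℕ
    θ = suc θ'

  module PeriodicPoint (Z : Seq n) (M' : ℕ) (Z-periodic : Periodic (suc M') Z) where

    z : Seq n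
    z = F Z

    period : ∃[ p ] suc p ≡ offsets Z (suc M')
    period = m≤n⇒∃[o]m+o≡n (Concatenation.0<offset-suc (words Z) M')

    p : ℕ
    p = proj₁ period

    z-periodic : Periodic (suc p) z
    z-periodic t = begin
      z (t + suc p)               ≡⟨ cong z (trans (+-comm t (suc p)) (cong (_+ t) (proj₂ period))) ⟩
      z (offsets Z (suc M') + t)  ≡⟨ dill-shift Z (suc M') t ⟩
      F (shift (suc M') Z) t      ≡⟨ dill-cong shift-Z≗Z t ⟩
      z t                         ∎
      where
      open ≡-Reasoning
      shift-Z≗Z : ∀ s → shift (suc M') Z s ≡ Z s
      shift-Z≗Z s = trans (cong Z (+-comm (suc M') s)) (Z-periodic s)

    open ShiftEquivalence z p z-periodic public

    patch : Seq n → Seq n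
    patch X = extend (window θ X 0) Z

    patch-agreeFrom-Z : ∀ X → AgreeFrom θ (patch X) Z
    patch-agreeFrom-Z X t θ≤t = extend-≥ _ Z θ≤t

    |f₀|-patch : ∀ X → |f₀| (patch X) ≡ |f₀| X
    |f₀|-patch X = cong (λ u → length (f u)) (window-extend (window θ X 0) Z)

    patch-agreeFrom : ∀ {d X Y} → AgreeFrom d X Y → AgreeFrom d (patch X) (patch Y)
    patch-agreeFrom {X = X} {Y} agree t d≤t with <-≤-connex t θ
    ... | inj₁ t<θ = trans (extend-window X Z t<θ) (trans (agree t d≤t) (sym (extend-window Y Z t<θ)))
    ... | inj₂ θ≤t = trans (patch-agreeFrom-Z X t θ≤t) (sym (patch-agreeFrom-Z Y t θ≤t))

    offsets-patch : ∀ X → offsets Z θ ∼ offsets (patch X) θ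
    offsets-patch X = shiftEq λ t → trans (sym (tail t)) (tails-agree t)
      where
      open ≡-Reasoning
      T = offsets (patch X) θ
      tail : ∀ t → F (patch X) (T + t) ≡ z (offsets Z θ + t)
      tail = dill-tail θ (patch-agreeFrom-Z X)
      tail-periodic : Periodic (suc p) (λ t → F (patch X) (T + t))
      tail-periodic t = begin
        F (patch X) (T + (t + suc p))  ≡⟨ tail (t + suc p) ⟩
        z (offsets Z θ + (t + suc p))  ≡⟨ cong z (+-assoc (offsets Z θ) t (suc p)) ⟨
        z (offsets Z θ + t + suc p)    ≡⟨ z-periodic (offsets Z θ + t) ⟩
        z (offsets Z θ + t)            ≡⟨ tail t ⟨
        F (patch X) (T + t)            ∎
      tails-agree : ∀ t → F (patch X) (T + t) ≡ z (T + t)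
      tails-agree = periodic-WeylZero⇒agree (F (patch X)) z T p tail-periodic
        (λ t → trans (cong z (sym (+-assoc T t _))) (z-periodic (T + t)))
        (preserves (patch X) Z (agreeFrom⇒WeylZero _ _ θ (patch-agreeFrom-Z X)))

    |f₀|-∼-agreeFrom : ∀ d {X Y} → AgreeFrom d X Y → |f₀| X ∼ |f₀| Y
    |f₀|-∼-agreeFrom zero {X} {Y} agree =
      ∼-reflexive (cong (λ u → length (f u)) (window-local {X} {Y} 0 λ r _ → agree r z≤n))
    -- The first θ words of A and B have equal total length modulo ∼; all but the
    -- first read only σ A and σ B, which agree from d, so induction cancels them.
    |f₀|-∼-agreeFrom (suc d) {X} {Y} agree = begin
      |f₀| X          ≡⟨ |f₀|-patch X ⟨
      |f₀| (patch X)  ≈⟨ +-cancelʳ first-words later-words ⟩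
      |f₀| (patch Y)  ≡⟨ |f₀|-patch Y ⟩
      |f₀| Y          ∎
      where
      open ∼-Reasoning
      A = patch X
      B = patch Y
      first-words : |f₀| A + offsets (σ A) θ' ∼ |f₀| B + offsets (σ B) θ'
      first-words = begin
        |f₀| A + offsets (σ A) θ'  ≡⟨ offsets-suc A θ' ⟨
        offsets A θ                ≈⟨ offsets-patch X ⟨
        offsets Z θ                ≈⟨ offsets-patch Y ⟩
        offsets B θ                ≡⟨ offsets-suc B θ' ⟩
        |f₀| B + offsets (σ B) θ'  ∎
      later-words : offsets (σ A) θ' ∼ offsets (σ B) θ'
      later-words = offset-cong-∼ (λ j → |f₀|-∼-agreeFrom d {shift j (σ A)} {shift j (σ B)}
        λ r d≤r → patch-agreeFrom agree (suc (j + r)) (s≤s (≤-trans d≤r (m≤n+m r j)))) θ'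

    |f₀|-∼ : ∀ X Y → |f₀| X ∼ |f₀| Y
    |f₀|-∼ X Y = begin
      |f₀| X          ≡⟨ |f₀|-patch X ⟨
      |f₀| (patch X)  ≈⟨ |f₀|-∼-agreeFrom θ (λ t θ≤t →
                          trans (patch-agreeFrom-Z X t θ≤t) (sym (patch-agreeFrom-Z Y t θ≤t))) ⟩
      |f₀| (patch Y)  ≡⟨ |f₀|-patch Y ⟩
      |f₀| Y          ∎
      where open ∼-Reasoning

    lengths-∼ : ∀ u v → length (f u) ∼ length (f v)
    lengths-∼ u v = begin
      length (f u)        ≡⟨ cong (λ w → length (f w)) (window-extend u Z) ⟨
      |f₀| (extend u Z)   ≈⟨ |f₀|-∼ (extend u Z) (extend v Z) ⟩
      |f₀| (extend v Z)   ≡⟨ cong (λ w → length (f w)) (window-extend v Z) ⟩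
      length (f v)        ∎
      where open ∼-Reasoning

    offsets-∼-* : ∀ m → offsets Z m ∼ m * |f₀| Z
    offsets-∼-* = offset-∼-* (λ j → |f₀|-∼ (shift j Z) Z)

  shorter⇒constant : ∀ {u v} → length (f u) < length (f v) → IsConstant F
  shorter⇒constant {u} {v} |fu|<|fv| x y i = begin
    F x i                  ≡⟨ dill-local i (λ t t<i+θ → Z-low (below t<i+θ)) ⟨
    F Z i                  ≡⟨ shifts-agree N∼0 i ⟨
    F Z (offsets Z N + i)  ≡⟨ dill-shift Z N i ⟩
    F (shift N Z) i        ≡⟨ dill-local i (λ t t<i+θ → Z-high (below t<i+θ)) ⟩
    F y i                  ∎
    where
    open ≡-Reasoning
    gap = m≤n⇒∃[o]m+o≡n |fu|<|fv|
    k = proj₁ gap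
    K = suc (i + θ)
    N = suc k * K
    Z : Seq n
    Z t = splice N x y (t % (N + N))
    Z-periodic : Periodic (N + N) Z
    Z-periodic t = cong (splice N x y) ([m+n]%n≡m%n t (N + N))
    -- N is a successor, so suc (pred (N + N)) reduces to N + N.
    open PeriodicPoint Z (pred (N + N)) Z-periodic
    below : ∀ {t} → t < i + θ → t < N
    below t<i+θ = ≤-trans (m≤n⇒m≤1+n t<i+θ) (m≤m+n K (k * K))
    Z-low : ∀ {t} → t < N → Z t ≡ x t
    Z-low t<N = trans (cong (splice N x y) (m<n⇒m%n≡m (≤-trans t<N (m≤m+n N N)))) (splice-< x y t<N)
    Z-high : ∀ {t} → t < N → Z (N + t) ≡ y t
    Z-high {t} t<N = trans (cong (splice N x y) (m<n⇒m%n≡m (+-monoʳ-< N t<N))) (splice-+ N x y t)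
    gap∼0 : suc k ∼ 0
    gap∼0 = difference∼0 (lengths-∼ u v) (trans (+-suc _ k) (proj₂ gap))
    N∼0 : offsets Z N ∼ 0
    N∼0 = ∼-trans (offsets-∼-* N)
      (∼-trans (∼-reflexive (*-assoc (suc k) K (|f₀| Z))) (*-∼0 gap∼0 (K * |f₀| Z)))

  unequal-lengths⇒constant : ∀ {u v} → length (f u) ≢ length (f v) → IsConstant F
  unequal-lengths⇒constant {u} {v} |fu|≢|fv| with <-cmp (length (f u)) (length (f v))
  ... | tri< lt _ _ = shorter⇒constant lt
  ... | tri≈ _ eq _ = contradiction eq |fu|≢|fv|
  ... | tri> _ _ gt = λ x y i → sym (shorter⇒constant gt y x i)

  ¬uniform⇒constant : ¬ IsUniform θ f → IsConstant F
  ¬uniform⇒constant ¬uniform x y i = decidable-stable (F x i ≟ᶠ F y i) λ Fxi≢Fyi →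
    ¬uniform λ u v → decidable-stable (length (f u) ≟ length (f v)) λ |fu|≢|fv| →
      Fxi≢Fyi (unequal-lengths⇒constant |fu|≢|fv| x y i)

proposition2 : (n θ : ℕ) → 1 ≤ θ → (f : Vec (Fin n) θ → List⁺ (Fin n))
    → (∀ (x y : Seq n) → WeylZero x y → WeylZero (dill θ f x) (dill θ f y))
    → IsConstant (dill θ f) ⊎ IsUniform θ f
proposition2 n (suc θ') _ f preserves with uniform? (suc θ') f
... | yes uniform  = inj₂ uniform
... | no  ¬uniform = inj₁ (WeylInvariant.¬uniform⇒constant f preserves ¬uniform)
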